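{- Let $\mathcal{A}_0=(A,\Rightarrow,0)$ be an algebra of type $(2,0)$, put $1:=0\Rightarrow 0$, and suppose that for all $x,y,z\in A$: (i) $x\Rightarrow x=1$, $x\Rightarrow 1=1$, $1\Rightarrow x=x$; (ii) $y\Rightarrow(x\Rightarrow y)=1$; (iii) $(x\Rightarrow y)\Rightarrow y=(y\Rightarrow x)\Rightarrow x$; (iv) $(((x\Rightarrow y)\Rightarrow y)\Rightarrow z)\Rightarrow(x\Rightarrow z)=1$; (I5) $0\Rightarrow x=1$. Define $\rceil x:=x\Rightarrow 0$ and $x\oplus y:=\rceil x\Rightarrow y$ for all $x,y\in A$. Then $\mathcal{B}(\mathcal{A}_0)=(A,\oplus,\rceil,0)$ is a basic algebra, and its implication $\rceil x\oplus y$ coincides with $x\Rightarrow y$ for all $x,y\in A$.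
   Context: A basic algebra is an algebra $(A,\oplus,\rceil,0)$ of type $(2,1,0)$ satisfying, for all $x,y,z$: (BA1) $x\oplus 0=x$; (BA2) $\rceil\rceil x=x$; (BA3) $\rceil(\rceil x\oplus y)\oplus y=\rceil(\rceil y\oplus x)\oplus x$; (BA4) $\rceil(\rceil(\rceil(x\oplus y)\oplus y)\oplus z)\oplus(x\oplus z)=1$, where $1:=\rceil 0$. The implication of a basic algebra is the term $\rceil x\oplus y$. -}

module Defs where

open import Level using (Level; suc)
open import Relation.Binary.PropositionalEquality using (_≡_)
open import Data.Product using (_×_)

record IsBasicAlgebra {a : Level} (A : Set a)
         (_⊕_ : A → A → A) (¬_ : A → A) (𝟎 : A) : Set a where
  field
    BA1 : ∀ x → (x ⊕ 𝟎) ≡ x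
    BA2 : ∀ x → (¬ (¬ x)) ≡ x
    BA3 : ∀ x y → ((¬ ((¬ x) ⊕ y)) ⊕ y) ≡ ((¬ ((¬ y) ⊕ x)) ⊕ x)
    BA4 : ∀ x y z →
      ((¬ ((¬ ((¬ (x ⊕ y)) ⊕ y)) ⊕ z)) ⊕ (x ⊕ z)) ≡ (¬ 𝟎)

record IsImplAlgebra {a : Level} (A : Set a) (_⇒_ : A → A → A) (𝟎 : A) : Set a where
  𝟏 : A
  𝟏 = 𝟎 ⇒ 𝟎
  field
    i-refl  : ∀ x → (x ⇒ x) ≡ 𝟏
    i-top   : ∀ x → (x ⇒ 𝟏) ≡ 𝟏
    i-left  : ∀ x → (𝟏 ⇒ x) ≡ x
    ii      : ∀ x y → (y ⇒ (x ⇒ y)) ≡ 𝟏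
    iii     : ∀ x y → ((x ⇒ y) ⇒ y) ≡ ((y ⇒ x) ⇒ x)
    iv      : ∀ x y z → ((((x ⇒ y) ⇒ y) ⇒ z) ⇒ (x ⇒ z)) ≡ 𝟏
    I5      : ∀ x → (𝟎 ⇒ x) ≡ 𝟏

module Derived {a : Level} {A : Set a} (_⇒_ : A → A → A) (𝟎 : A) where
  ¬ᴮ : A → A
  ¬ᴮ x = x ⇒ 𝟎

  _⊕ᴮ_ : A → A → A
  x ⊕ᴮ y = (¬ᴮ x) ⇒ y

module Submission where

open import Defs
open import Level using (Level)
open import Relation.Binary.PropositionalEquality using (_≡_; cong; module ≡-Reasoning)
open import Data.Product using (_×_; _,_)

-- Negation x ⇒ 0 is involutive by (iii) with y = 0 and (I5), so the double
-- negations introduced by ⊕ cancel; (BA3) and (BA4) then become (iii) and (iv).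
module ImplAlgebraProperties {a : Level} {A : Set a} {_⇒_ : A → A → A} {𝟎 : A}
                             (H : IsImplAlgebra A _⇒_ 𝟎) where
  open IsImplAlgebra H
  open Derived _⇒_ 𝟎
  open ≡-Reasoning

  ¬ᴮ-involutive : ∀ x → ¬ᴮ (¬ᴮ x) ≡ x
  ¬ᴮ-involutive x = begin
    (x ⇒ 𝟎) ⇒ 𝟎   ≡⟨ iii x 𝟎 ⟩
    (𝟎 ⇒ x) ⇒ x   ≡⟨ cong (_⇒ x) (I5 x) ⟩
    𝟏 ⇒ x         ≡⟨ i-left x ⟩
    x             ∎

  ⊕ᴮ-identityʳ : ∀ x → x ⊕ᴮ 𝟎 ≡ x
  ⊕ᴮ-identityʳ = ¬ᴮ-involutive

  ⊕ᴮ-implication : ∀ x y → (¬ᴮ x) ⊕ᴮ y ≡ x ⇒ y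
  ⊕ᴮ-implication x y = cong (_⇒ y) (¬ᴮ-involutive x)

  ⊕ᴮ-join-comm : ∀ x y → (¬ᴮ ((¬ᴮ x) ⊕ᴮ y)) ⊕ᴮ y ≡ (¬ᴮ ((¬ᴮ y) ⊕ᴮ x)) ⊕ᴮ x
  ⊕ᴮ-join-comm x y = begin
    (¬ᴮ ((¬ᴮ x) ⊕ᴮ y)) ⊕ᴮ y   ≡⟨ ⊕ᴮ-implication _ y ⟩
    ((¬ᴮ x) ⊕ᴮ y) ⇒ y         ≡⟨ cong (_⇒ y) (⊕ᴮ-implication x y) ⟩
    (x ⇒ y) ⇒ y               ≡⟨ iii x y ⟩
    (y ⇒ x) ⇒ x               ≡⟨ cong (_⇒ x) (⊕ᴮ-implication y x) ⟨
    ((¬ᴮ y) ⊕ᴮ x) ⇒ x         ≡⟨ ⊕ᴮ-implication _ x ⟨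
    (¬ᴮ ((¬ᴮ y) ⊕ᴮ x)) ⊕ᴮ x   ∎

  ⊕ᴮ-antitone : ∀ x y z → (¬ᴮ ((¬ᴮ ((¬ᴮ (x ⊕ᴮ y)) ⊕ᴮ y)) ⊕ᴮ z)) ⊕ᴮ (x ⊕ᴮ z) ≡ ¬ᴮ 𝟎
  ⊕ᴮ-antitone x y z = begin
    (¬ᴮ ((¬ᴮ ((¬ᴮ (x ⊕ᴮ y)) ⊕ᴮ y)) ⊕ᴮ z)) ⊕ᴮ (x ⊕ᴮ z)
      ≡⟨ ⊕ᴮ-implication _ _ ⟩
    ((¬ᴮ ((¬ᴮ (x ⊕ᴮ y)) ⊕ᴮ y)) ⊕ᴮ z) ⇒ (x ⊕ᴮ z)
      ≡⟨ cong (_⇒ (x ⊕ᴮ z)) (⊕ᴮ-implication _ z) ⟩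
    (((¬ᴮ (x ⊕ᴮ y)) ⊕ᴮ y) ⇒ z) ⇒ (x ⊕ᴮ z)
      ≡⟨ cong (λ w → (w ⇒ z) ⇒ (x ⊕ᴮ z)) (⊕ᴮ-implication (x ⊕ᴮ y) y) ⟩
    ((((¬ᴮ x) ⇒ y) ⇒ y) ⇒ z) ⇒ ((¬ᴮ x) ⇒ z)
      ≡⟨ iv (¬ᴮ x) y z ⟩
    𝟏 ∎

  isBasicAlgebra : IsBasicAlgebra A _⊕ᴮ_ ¬ᴮ 𝟎
  isBasicAlgebra = record
    { BA1 = ⊕ᴮ-identityʳ
    ; BA2 = ¬ᴮ-involutive
    ; BA3 = ⊕ᴮ-join-comm
    ; BA4 = ⊕ᴮ-antitone
    }

theorem6 : {a : Level} (A : Set a) (_⇒_ : A → A → A) (𝟎 : A) →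
    IsImplAlgebra A _⇒_ 𝟎 →
    IsBasicAlgebra A (Derived._⊕ᴮ_ _⇒_ 𝟎) (Derived.¬ᴮ _⇒_ 𝟎) 𝟎
      × (∀ x y → Derived._⊕ᴮ_ _⇒_ 𝟎 (Derived.¬ᴮ _⇒_ 𝟎 x) y ≡ (x ⇒ y))
theorem6 A _⇒_ 𝟎 H = isBasicAlgebra , ⊕ᴮ-implication
  where open ImplAlgebraProperties H
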